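{- Let $G$ be a finite simple graph with at least one edge. Then the treewidth of $G$ is at most the cocircumference of $G$.
   Context: A bond in a graph $G$ is an inclusion-wise minimal set of edges $F$ such that $G-F$ has more connected components than $G$. The cocircumference of a graph with at least one edge is the largest size of a bond in it. A tree-decomposition of $G$ is a family $\{X_u : u\in V(T)\}$ of subsets of $V(G)$ indexed by the nodes of a tree $T$ such that for every vertex $x$ the nodes $u$ with $x\in X_u$ induce a non-empty subtree of $T$, and every edge of $G$ has both ends in some $X_u$; its width is $\max_u |X_u|-1$, and the treewidth of $G$ is the minimum width of a tree-decomposition of $G$. -}

module Defs where

open import Data.Nat using (ℕ; zero; suc; _+_; _≤_; _<_)
open import Data.Fin using (Fin)
import Data.Fin as F
open import Data.Fin.Subset using (Subset; _∈_; ∣_∣)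
open import Data.Bool using (Bool; true; false; _∧_; _∨_; not; if_then_else_)
open import Data.List using (List; map)
open import Data.Nat.ListAction using (sum)
open import Data.Nat using (_<ᵇ_; _≡ᵇ_)
open import Data.Vec using (allFin; toList)
open import Data.Product using (Σ; ∃; _×_; _,_)
open import Data.Empty using (⊥)
open import Relation.Nullary using (¬_)
open import Relation.Binary.PropositionalEquality using (_≡_)

record Graph (n : ℕ) : Set where
  field
    adj   : Fin n → Fin n → Bool
    sym   : ∀ u v → adj u v ≡ adj v u
    irrefl : ∀ u → adj u u ≡ false
open Graph public

Rel : ℕ → Set
Rel n = Fin n → Fin n → Bool

data ConnIn {n : ℕ} (A : Rel n) (P : Fin n → Set) : Fin n → Fin n → Set where
  here : ∀ {u} → P u → ConnIn A P u u
  step : ∀ {u w v} → P u → A u w ≡ true → ConnIn A P w v → ConnIn A P u v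

data Top {n : ℕ} : Fin n → Set where
  tt : ∀ {u} → Top u

Conn : ∀ {n} → Rel n → Fin n → Fin n → Set
Conn A = ConnIn A Top

-- The graph with adjacency A has exactly k connected components:
-- there is a set of representatives, one per component, of size k.
ComponentCount : ∀ {n} → Rel n → ℕ → Set
ComponentCount {n} A k =
  Σ (Subset n) λ S →
    (∣ S ∣ ≡ k)
    × (∀ v → Σ (Fin n) λ r → (r ∈ S) × Conn A v r)
    × (∀ r r' → r ∈ S → r' ∈ S → Conn A r r' → r ≡ r')

record EdgeSet {n : ℕ} (G : Graph n) : Set where
  field
    mem    : Rel n
    memSym : ∀ u v → mem u v ≡ mem v u
    memSub : ∀ u v → mem u v ≡ true → adj G u v ≡ true
open EdgeSet public

countRel : ∀ {n} → Rel n → ℕ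
countRel {n} A =
  sum (map (λ u → sum (map (λ v → if ((F.toℕ u <ᵇ F.toℕ v) ∧ A u v) then 1 else 0)
                             (toList (allFin n))))
           (toList (allFin n)))

size : ∀ {n} {G : Graph n} → EdgeSet G → ℕ
size F = countRel (mem F)

delete : ∀ {n} → Rel n → Rel n → Rel n
delete A F u v = A u v ∧ not (F u v)

Disconnects : ∀ {n} (G : Graph n) → EdgeSet G → Set
Disconnects G F = ∀ k k' → ComponentCount (adj G) k
                         → ComponentCount (delete (adj G) (mem F)) k' → k < k'

_⊂E_ : ∀ {n} {G : Graph n} → EdgeSet G → EdgeSet G → Set
F' ⊂E F = (∀ u v → mem F' u v ≡ true → mem F u v ≡ true)
          × Σ _ λ u → Σ _ λ v → (mem F u v ≡ true) × (mem F' u v ≡ false)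

IsBond : ∀ {n} (G : Graph n) → EdgeSet G → Set
IsBond G F = Disconnects G F × (∀ F' → F' ⊂E F → ¬ Disconnects G F')

IsCocircumference : ∀ {n} → Graph n → ℕ → Set
IsCocircumference G c =
  (Σ (EdgeSet G) λ F → IsBond G F × (size F ≡ c))
  × (∀ F → IsBond G F → size F ≤ c)

removeEdge : ∀ {m} → Rel m → Fin m → Fin m → Rel m
removeEdge A a b u v =
  A u v ∧ not ((eqF u a ∧ eqF v b) ∨ (eqF u b ∧ eqF v a))
  where
  eqF : Fin _ → Fin _ → Bool
  eqF x y = F.toℕ x ≡ᵇ F.toℕ y

IsTree : ∀ {m} → Graph m → Set
IsTree {m} T =
  (1 ≤ m)
  × (∀ u v → Conn (adj T) u v)
  × (∀ u v → adj T u v ≡ true → ¬ Conn (removeEdge (adj T) u v) u v)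

record TreeDecomposition {n : ℕ} (G : Graph n) : Set where
  field
    m       : ℕ
    tree    : Graph m
    isTree  : IsTree tree
    bag     : Fin m → Subset n
    nonEmpty  : ∀ x → Σ (Fin m) λ t → x ∈ bag t
    connected : ∀ x t t' → x ∈ bag t → x ∈ bag t'
                → ConnIn (adj tree) (λ s → x ∈ bag s) t t'
    covers  : ∀ x y → adj G x y ≡ true → Σ (Fin m) λ t → (x ∈ bag t) × (y ∈ bag t)
open TreeDecomposition public

HasWidth : ∀ {n} {G : Graph n} → TreeDecomposition G → ℕ → Set
HasWidth D w = (∀ t → ∣ bag D t ∣ ≤ suc w) × Σ (Fin (m D)) λ t → ∣ bag D t ∣ ≡ suc w

IsTreewidth : ∀ {n} → Graph n → ℕ → Set
IsTreewidth G tw =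
  (Σ (TreeDecomposition G) λ D → HasWidth D tw)
  × (∀ (D : TreeDecomposition G) w → HasWidth D w → tw ≤ w)

HasEdge : ∀ {n} → Graph n → Set
HasEdge {n} G = Σ (Fin n) λ u → Σ (Fin n) λ v → adj G u v ≡ true

-- Take a normal spanning tree: a rooted spanning tree of G, with its component roots attached
-- to one global root, in which every edge of G joins a vertex to one of its ancestors.  Let the
-- bag of a node t be t together with the neighbours of the set D of vertices below t;
-- normality makes these neighbours ancestors of t, which gives a tree-decomposition.  For t
-- other than the root, D is connected through the tree and every component minus D stays
-- connected through root paths, which avoid D; hence the edges leaving D form a bond.  Each
-- neighbour of D is the outer end of one of these edges, so every bag has at most
-- cocircumference + 1 vertices.

module Submission where

open import Defs renaming (sym to adj-sym)
open import Data.Nat.Properties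
  using ( ≤-refl; ≤-trans; <-irrefl; n≮0; 1+n≢n; m≤m+n; m≤n+m; +-comm; +-suc
        ; +-mono-≤; +-monoʳ-≤; +-mono-<-≤; +-mono-≤-<; ≡ᵇ⇒≡; ≡⇒≡ᵇ; <-cmp; <⇒<ᵇ
        ; +-0-commutativeMonoid; ≤-totalOrder; module ≤-Reasoning )
open import Algebra.Properties.CommutativeMonoid.Sum +-0-commutativeMonoid
  using (sum-syntax; sum-cong-≗; ∑-distrib-+; ∑-comm)
open import Data.Bool using (Bool; true; false; _∧_; _∨_; not; _xor_; if_then_else_)
open import Data.Bool.Properties using (T-≡; ∨-comm; ∨-zeroʳ; ∧-zeroʳ; ∧-identityʳ; xor-comm; xor-same)
open import Data.Empty using (⊥; ⊥-elim)
open import Data.Fin using (Fin; zero; suc; toℕ)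
open import Data.Fin.Properties using (_≟_; toℕ-injective)
open import Data.Fin.Subset using (Subset; _∈_; ∣_∣; _∪_; ⁅_⁆)
open import Data.Fin.Subset.Properties
  using ( ∣p∣≤n; ∣p∣≤∣x∷p∣; p⊂q⇒∣p∣<∣q∣; x∈p⇒∣p-x∣<∣p∣; x∈⁅x⁆; x∈⁅y⁆⇒x≡y
        ; x∈p∪q⁺; x∈p∪q⁻; ∣⁅x⁆∣≡1; nonempty?; Empty-unique; ∣⊥∣≡0 )
import Data.List as List
open import Data.List using (List; []; _∷_; _++_; length; map)
open import Data.List.Extrema ≤-totalOrder using (argmax; f[xs]≤f[argmax])
open import Data.List.Membership.Propositional using () renaming (_∈_ to _∈ₗ_)
open import Data.List.Membership.Propositional.Properties using (∈-++⁺ˡ; ∈-++⁺ʳ; ∈-++⁻; ∈-allFin)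
import Data.List.Membership.DecPropositional as DecMembership
open import Data.List.Properties using (length-++; ∷-injectiveˡ; ∷-injectiveʳ; map-cong)
import Data.List.Relation.Unary.All as All
import Data.List.Relation.Unary.Any as Any
open import Data.Maybe as Maybe using (Maybe; just; nothing; fromMaybe)
open import Data.Nat using (ℕ; zero; suc; _+_; _≤_; _<_; z≤n; s≤s; s≤s⁻¹; _≡ᵇ_; _<ᵇ_)
open import Data.Nat.ListAction using (sum)
open import Data.Product using (∃; _×_; _,_; proj₁; proj₂)
open import Data.Sum as Sum using (_⊎_; inj₁; inj₂)
open import Data.Vec as Vec using (tabulate; allFin; toList; lookup; _∷_)
open import Data.Vec.Properties using (lookup⇒[]=; []=⇒lookup; lookup∘tabulate; tabulate∘lookup)
open import Function using (Equivalence; case_of_)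
open import Relation.Binary.Definitions using (tri<; tri≈; tri>)
open import Relation.Binary.PropositionalEquality
open import Relation.Nullary using (¬_; does; yes; no)
open import Relation.Nullary.Decidable using (dec-true; dec-false)

-- Booleans and counting

𝟙 : Bool → ℕ
𝟙 b = if b then 1 else 0

𝟙≤1 : ∀ b → 𝟙 b ≤ 1
𝟙≤1 true  = ≤-refl
𝟙≤1 false = z≤n

true≢false : true ≢ false
true≢false ()

∧-true⁻ : ∀ {a b} → a ∧ b ≡ true → a ≡ true × b ≡ true
∧-true⁻ {true} {true} _ = refl , refl

∨-true⁻ : ∀ {a b} → a ∨ b ≡ true → a ≡ true ⊎ b ≡ true
∨-true⁻ {true}  _ = inj₁ refl
∨-true⁻ {false} e = inj₂ e

not-true⁻ : ∀ {b} → not b ≡ true → b ≡ false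
not-true⁻ {false} _ = refl

true⇔⇒≡ : ∀ {a b} → (a ≡ true → b ≡ true) → (b ≡ true → a ≡ true) → a ≡ b
true⇔⇒≡ {true}          a⇒b _ = sym (a⇒b refl)
true⇔⇒≡ {false} {true}  _ b⇒a = b⇒a refl
true⇔⇒≡ {false} {false} _ _   = refl

Bool-cases : ∀ b → b ≡ true ⊎ b ≡ false
Bool-cases true  = inj₁ refl
Bool-cases false = inj₂ refl

module _ {n : ℕ} where

  -- Boolean equality and order on Fin n, in the form used by removeEdge and countRel.
  _==_ : Fin n → Fin n → Bool
  x == y = toℕ x ≡ᵇ toℕ y

  ==-refl : ∀ x → x == x ≡ true
  ==-refl x = Equivalence.to T-≡ (≡⇒≡ᵇ (toℕ x) (toℕ x) refl)

  ==⇒≡ : ∀ {x y} → x == y ≡ true → x ≡ y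
  ==⇒≡ {x} {y} e = toℕ-injective (≡ᵇ⇒≡ (toℕ x) (toℕ y) (Equivalence.from T-≡ e))

  ==-false⇒≢ : ∀ {x y} → x == y ≡ false → x ≢ y
  ==-false⇒≢ {x} e refl = true≢false (trans (sym (==-refl x)) e)

  ≢⇒==-false : ∀ {x y} → x ≢ y → x == y ≡ false
  ≢⇒==-false {x} {y} x≢y with x == y in e
  ... | true  = ⊥-elim (x≢y (==⇒≡ e))
  ... | false = refl

  _<ᶠ_ : Fin n → Fin n → Bool
  x <ᶠ y = toℕ x <ᵇ toℕ y

  <ᶠ-connex : ∀ {x y} → x ≢ y → x <ᶠ y ≡ true ⊎ y <ᶠ x ≡ true
  <ᶠ-connex {x} {y} x≢y with <-cmp (toℕ x) (toℕ y)
  ... | tri< x<y _ _ = inj₁ (Equivalence.to T-≡ (<⇒<ᵇ x<y))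
  ... | tri≈ _ x≡y _ = ⊥-elim (x≢y (toℕ-injective x≡y))
  ... | tri> _ _ y<x = inj₂ (Equivalence.to T-≡ (<⇒<ᵇ y<x))

  ==-flip : ∀ {x y} → x == y ≡ true → y == x ≡ true
  ==-flip {x} {y} e rewrite ==⇒≡ {x} {y} e = ==-refl y

  ==-sym : ∀ x y → x == y ≡ y == x
  ==-sym x y = true⇔⇒≡ (==-flip {x} {y}) (==-flip {y} {x})

any : ∀ {n} → (Fin n → Bool) → Bool
any {zero}  f = false
any {suc n} f = f zero ∨ any (λ i → f (suc i))

any-witness : ∀ {n} (f : Fin n → Bool) → any f ≡ true → ∃ λ i → f i ≡ true
any-witness {suc n} f e with ∨-true⁻ {f zero} e
... | inj₁ f0 = zero , f0
... | inj₂ fs with any-witness (λ i → f (suc i)) fs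
...   | i , fi = suc i , fi

any-intro : ∀ {n} (f : Fin n → Bool) i → f i ≡ true → any f ≡ true
any-intro f zero    e rewrite e = refl
any-intro f (suc i) e rewrite any-intro (λ i → f (suc i)) i e = ∨-zeroʳ (f zero)

any-false : ∀ {n} (f : Fin n → Bool) → any f ≡ false → ∀ i → f i ≡ false
any-false f e i with Bool-cases (f i)
... | inj₁ fi = ⊥-elim (true≢false (trans (sym (any-intro f i fi)) e))
... | inj₂ fi = fi

first : ∀ {n} → (Fin n → Bool) → Maybe (Fin n)
first {zero}  f = nothing
first {suc n} f = if f zero then just zero else Maybe.map suc (first (λ i → f (suc i)))

first-sound : ∀ {n} (f : Fin n → Bool) {i} → first f ≡ just i → f i ≡ true
first-sound {suc n} f e with f zero in f0
first-sound {suc n} f refl | true = f0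
... | false with first (λ i → f (suc i)) in e′
first-sound {suc n} f refl | false | just i = first-sound (λ i → f (suc i)) e′

first-complete : ∀ {n} (f : Fin n → Bool) i → f i ≡ true → ∃ λ j → first f ≡ just j
first-complete {suc n} f i fi with f zero in f0
... | true = zero , refl
first-complete {suc n} f zero    fi | false = ⊥-elim (true≢false (trans (sym fi) f0))
first-complete {suc n} f (suc i) fi | false with first-complete (λ i → f (suc i)) i fi
... | j , e rewrite e = suc j , refl

first-cong : ∀ {n} {f g : Fin n → Bool} → (∀ i → f i ≡ g i) → first f ≡ first g
first-cong {zero}  e = refl
first-cong {suc n} e rewrite e zero | first-cong (λ i → e (suc i)) = refl

term≤∑ : ∀ {n} (f : Fin n → ℕ) i → f i ≤ ∑[ j < n ] f j
term≤∑ f zero    = m≤m+n _ _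
term≤∑ f (suc i) = ≤-trans (term≤∑ (λ j → f (suc j)) i) (m≤n+m _ _)

two-terms≤∑ : ∀ {n} (f : Fin n → ℕ) {i j} → i ≢ j → f i + f j ≤ ∑[ k < n ] f k
two-terms≤∑ f {zero}  {zero}  i≢j = ⊥-elim (i≢j refl)
two-terms≤∑ f {zero}  {suc j} _   = +-monoʳ-≤ (f zero) (term≤∑ (λ k → f (suc k)) j)
two-terms≤∑ f {suc i} {zero}  _   =
  subst (_≤ ∑[ k < suc _ ] f k) (+-comm (f zero) (f (suc i)))
    (+-monoʳ-≤ (f zero) (term≤∑ (λ k → f (suc k)) i))
two-terms≤∑ f {suc i} {suc j} i≢j =
  ≤-trans (two-terms≤∑ (λ k → f (suc k)) (λ i≡j → i≢j (cong suc i≡j))) (m≤n+m _ _)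

∑-mono-≤ : ∀ {n} {f g : Fin n → ℕ} → (∀ i → f i ≤ g i) → ∑[ i < n ] f i ≤ ∑[ i < n ] g i
∑-mono-≤ {zero}  _   = z≤n
∑-mono-≤ {suc n} f≤g = +-mono-≤ (f≤g zero) (∑-mono-≤ (λ i → f≤g (suc i)))

∑-mono-< : ∀ {n} {f g : Fin n → ℕ} → (∀ i → f i ≤ g i) → ∀ j → f j < g j →
           ∑[ i < n ] f i < ∑[ i < n ] g i
∑-mono-< f≤g zero    lt = +-mono-<-≤ lt (∑-mono-≤ (λ i → f≤g (suc i)))
∑-mono-< f≤g (suc j) lt = +-mono-≤-< (f≤g zero) (∑-mono-< (λ i → f≤g (suc i)) j lt)

∑0≡0 : ∀ n → ∑[ i < n ] 0 ≡ 0
∑0≡0 zero    = refl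
∑0≡0 (suc n) = ∑0≡0 n

∑𝟙== : ∀ {n} (j : Fin n) → ∑[ i < n ] 𝟙 (i == j) ≡ 1
∑𝟙== {suc n} zero    = cong suc (∑0≡0 n)
∑𝟙== {suc n} (suc j) = ∑𝟙== j

∑∑ : ∀ {n} → (Fin n → Fin n → ℕ) → ℕ
∑∑ {n} f = ∑[ u < n ] ∑[ v < n ] f u v

∑∑-distrib-+ : ∀ {n} (f g : Fin n → Fin n → ℕ) → ∑∑ (λ u v → f u v + g u v) ≡ ∑∑ f + ∑∑ g
∑∑-distrib-+ {n} f g = trans (sum-cong-≗ (λ u → ∑-distrib-+ (f u) (g u)))
                             (∑-distrib-+ (λ u → ∑[ v < n ] f u v) (λ u → ∑[ v < n ] g u v))

∑-allFin : ∀ {n} (f : Fin n → ℕ) → sum (map f (toList (allFin n))) ≡ ∑[ i < n ] f i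
∑-allFin {n} f = go n (λ i → i)
  where
  go : ∀ m (g : Fin m → Fin n) → sum (map f (toList (tabulate g))) ≡ ∑[ i < m ] f (g i)
  go zero    g = refl
  go (suc m) g = cong (f (g zero) +_) (go m (λ i → g (suc i)))

countRel≡∑∑ : ∀ {n} (R : Rel n) → countRel R ≡ ∑∑ (λ u v → 𝟙 (u <ᶠ v ∧ R u v))
countRel≡∑∑ {n} R =
  trans (cong sum (map-cong (λ u → ∑-allFin (λ v → 𝟙 (u <ᶠ v ∧ R u v))) (toList (allFin n))))
        (∑-allFin (λ u → ∑[ v < n ] 𝟙 (u <ᶠ v ∧ R u v)))

module _ {n : ℕ} where

  ∈-tabulate⁺ : ∀ {b : Fin n → Bool} {i} → b i ≡ true → i ∈ tabulate b
  ∈-tabulate⁺ {b} {i} e = lookup⇒[]= i (tabulate b) (trans (lookup∘tabulate b i) e)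

  ∈-tabulate⁻ : ∀ {b : Fin n → Bool} {i} → i ∈ tabulate b → b i ≡ true
  ∈-tabulate⁻ {b} {i} p = trans (sym (lookup∘tabulate b i)) ([]=⇒lookup p)

∣tabulate∣≡∑𝟙 : ∀ {n} (b : Fin n → Bool) → ∣ tabulate b ∣ ≡ ∑[ i < n ] 𝟙 (b i)
∣tabulate∣≡∑𝟙 {zero}  b = refl
∣tabulate∣≡∑𝟙 {suc n} b with b zero
... | true  = cong suc (∣tabulate∣≡∑𝟙 (λ i → b (suc i)))
... | false = ∣tabulate∣≡∑𝟙 (λ i → b (suc i))

∣p∣≡∑𝟙 : ∀ {n} (p : Subset n) → ∣ p ∣ ≡ ∑[ i < n ] 𝟙 (lookup p i)
∣p∣≡∑𝟙 p = trans (cong ∣_∣ (sym (tabulate∘lookup p))) (∣tabulate∣≡∑𝟙 (lookup p))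

x∈p⇒0<∣p∣ : ∀ {n} {p : Subset n} {x} → x ∈ p → 0 < ∣ p ∣
x∈p⇒0<∣p∣ x∈p = ≤-trans (s≤s z≤n) (x∈p⇒∣p-x∣<∣p∣ x∈p)

∣tabulate∣-mono-< : ∀ {n} {b c : Fin n → Bool} → (∀ i → b i ≡ true → c i ≡ true) →
                    ∀ {j} → b j ≡ false → c j ≡ true → ∣ tabulate b ∣ < ∣ tabulate c ∣
∣tabulate∣-mono-< {b = b} {c} b⇒c {j} bj cj = p⊂q⇒∣p∣<∣q∣ {p = tabulate b} {tabulate c}
  ( (λ i∈b → ∈-tabulate⁺ (b⇒c _ (∈-tabulate⁻ i∈b)))
  , j , ∈-tabulate⁺ cj , λ j∈b → true≢false (trans (sym (∈-tabulate⁻ j∈b)) bj))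

∣p∪q∣≤∣p∣+∣q∣ : ∀ {n} (p q : Subset n) → ∣ p ∪ q ∣ ≤ ∣ p ∣ + ∣ q ∣
∣p∪q∣≤∣p∣+∣q∣ Vec.[] Vec.[] = z≤n
∣p∪q∣≤∣p∣+∣q∣ (true  ∷ p) (s ∷ q) = s≤s (≤-trans (∣p∪q∣≤∣p∣+∣q∣ p q) (+-monoʳ-≤ ∣ p ∣ (∣p∣≤∣x∷p∣ s q)))
∣p∪q∣≤∣p∣+∣q∣ (false ∷ p) (true ∷ q) =
  subst (suc ∣ p ∪ q ∣ ≤_) (sym (+-suc ∣ p ∣ ∣ q ∣)) (s≤s (∣p∪q∣≤∣p∣+∣q∣ p q))
∣p∪q∣≤∣p∣+∣q∣ (false ∷ p) (false ∷ q) = ∣p∪q∣≤∣p∣+∣q∣ p q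

-- Count q fibre by fibre over f.
onto-non-injective⇒∣p∣<∣q∣ :
  ∀ {n} (p q : Subset n) (f : Fin n → Fin n) →
  (∀ {x} → x ∈ p → ∃ λ y → y ∈ q × f y ≡ x) →
  ∀ {y₁ y₂} → y₁ ∈ q → y₂ ∈ q → y₁ ≢ y₂ → f y₁ ≡ f y₂ →
  ∣ p ∣ < ∣ q ∣
onto-non-injective⇒∣p∣<∣q∣ {n} p q f onto {y₁} {y₂} y₁∈q y₂∈q y₁≢y₂ fy₁≡fy₂ =
  subst₂ _<_ (sym (∣p∣≡∑𝟙 p)) (sym ∣q∣≡∑fibre) (∑-mono-< p≤fibre (f y₁) strict)
  where
  fibre : Fin n → ℕ
  fibre x = ∑[ y < n ] 𝟙 (lookup q y ∧ (f y == x))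

  ∑𝟙-∧== : ∀ b (y : Fin n) → ∑[ x < n ] 𝟙 (b ∧ (f y == x)) ≡ 𝟙 b
  ∑𝟙-∧== false y = ∑0≡0 n
  ∑𝟙-∧== true  y = trans (sum-cong-≗ (λ x → cong 𝟙 (==-sym (f y) x))) (∑𝟙== (f y))

  ∣q∣≡∑fibre : ∣ q ∣ ≡ ∑[ x < n ] fibre x
  ∣q∣≡∑fibre = begin
    ∣ q ∣                                                ≡⟨ ∣p∣≡∑𝟙 q ⟩
    ∑[ y < n ] 𝟙 (lookup q y)                            ≡⟨ sum-cong-≗ (λ y → sym (∑𝟙-∧== (lookup q y) y)) ⟩
    ∑[ y < n ] ∑[ x < n ] 𝟙 (lookup q y ∧ (f y == x))    ≡⟨ ∑-comm (λ y x → 𝟙 (lookup q y ∧ (f y == x))) ⟩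
    ∑[ x < n ] fibre x                                   ∎
    where open ≡-Reasoning

  in-fibre : ∀ {y} → y ∈ q → 𝟙 (lookup q y ∧ (f y == f y)) ≡ 1
  in-fibre {y} y∈q rewrite []=⇒lookup y∈q | ==-refl (f y) = refl

  p≤fibre : ∀ x → 𝟙 (lookup p x) ≤ fibre x
  p≤fibre x with Bool-cases (lookup p x)
  ... | inj₂ e rewrite e = z≤n
  ... | inj₁ e with onto (lookup⇒[]= x p e)
  ...   | y , y∈q , refl rewrite e =
    subst (_≤ fibre (f y)) (in-fibre y∈q) (term≤∑ (λ y′ → 𝟙 (lookup q y′ ∧ (f y′ == f y))) y)

  strict : 𝟙 (lookup p (f y₁)) < fibre (f y₁)
  strict = ≤-trans (s≤s (𝟙≤1 (lookup p (f y₁))))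
    (subst₂ (λ a b → a + b ≤ fibre (f y₁)) (in-fibre y₁∈q)
      (trans (cong (λ z → 𝟙 (lookup q y₂ ∧ (f y₂ == z))) fy₁≡fy₂) (in-fibre y₂∈q))
      (two-terms≤∑ (λ y → 𝟙 (lookup q y ∧ (f y == f y₁))) y₁≢y₂))

-- Walks and reachability

module _ {n : ℕ} where

  connIn-head : ∀ {A : Rel n} {P a b} → ConnIn A P a b → P a
  connIn-head (here p)     = p
  connIn-head (step p _ _) = p

  connIn-last : ∀ {A : Rel n} {P a b} → ConnIn A P a b → P b
  connIn-last (here p)     = p
  connIn-last (step _ _ w) = connIn-last w

  connIn-trans : ∀ {A : Rel n} {P a b c} → ConnIn A P a b → ConnIn A P b c → ConnIn A P a c
  connIn-trans (here _)     w′ = w′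
  connIn-trans (step p e w) w′ = step p e (connIn-trans w w′)

  connIn-snoc : ∀ {A : Rel n} {P a b c} → ConnIn A P a b → A b c ≡ true → P c → ConnIn A P a c
  connIn-snoc w e pc = connIn-trans w (step (connIn-last w) e (here pc))

  connIn-sym : ∀ {A : Rel n} {P a b} → (∀ u v → A u v ≡ A v u) → ConnIn A P a b → ConnIn A P b a
  connIn-sym A-sym (here p) = here p
  connIn-sym A-sym (step {u} {w} p e r) = connIn-snoc (connIn-sym A-sym r) (trans (A-sym w u) e) p

  connIn-map : ∀ {A B : Rel n} {P Q : Fin n → Set} {a b} → (∀ {z} → P z → Q z) →
               (∀ {z w} → P z → P w → A z w ≡ true → B z w ≡ true) →
               ConnIn A P a b → ConnIn B Q a b
  connIn-map f g (here p)     = here (f p)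
  connIn-map f g (step p e w) = step (f p) (g p (connIn-head w) e) (connIn-map f g w)

  forget : ∀ {A : Rel n} {P a b} → ConnIn A P a b → Conn A a b
  forget = connIn-map (λ _ → tt) (λ _ _ e → e)

  connIn-invariant : ∀ {A : Rel n} {P a b} (f : Fin n → Bool) →
                     (∀ {z w} → P z → P w → A z w ≡ true → f z ≡ f w) →
                     ConnIn A P a b → f a ≡ f b
  connIn-invariant f g (here _)     = refl
  connIn-invariant f g (step p e w) = trans (g p (connIn-head w) e) (connIn-invariant f g w)

  connIn-prefixes : ∀ {A : Rel n} {P a b} → ConnIn A P a b → ConnIn A (ConnIn A P a) a b
  connIn-prefixes {A} {P} {a} w = go (here (connIn-head w)) w
    where
    go : ∀ {c b} → ConnIn A P a c → ConnIn A P c b → ConnIn A (ConnIn A P a) c b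
    go w₀ (here _)     = here w₀
    go w₀ (step _ e w) = step w₀ e (go (connIn-snoc w₀ e (connIn-head w)) w)

  conn-edges : ∀ {A B : Rel n} → (∀ {x y} → A x y ≡ true → Conn B x y) → ∀ {a b} → Conn A a b → Conn B a b
  conn-edges h (here _)     = here tt
  conn-edges h (step _ e w) = connIn-trans (h e) (conn-edges h w)

In : ∀ {n} → (Fin n → Bool) → Fin n → Set
In P z = P z ≡ true

module Reachability {n : ℕ} (A : Rel n) (Q : Fin n → Bool) (u : Fin n) where

  frontier : (Fin n → Bool) → Fin n → Bool
  frontier R z = Q z ∧ any (λ y → R y ∧ A y z)

  within : ℕ → Fin n → Bool
  within zero    z = Q u ∧ (z == u)
  within (suc i) z = within i z ∨ frontier (within i) z

  within-sound : ∀ i {z} → within i z ≡ true → ConnIn A (In Q) u z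
  within-sound zero {z} e with ∧-true⁻ {Q u} e
  ... | qu , z==u = subst (ConnIn A (In Q) u) (sym (==⇒≡ {x = z} z==u)) (here qu)
  within-sound (suc i) e with ∨-true⁻ e
  ... | inj₁ old = within-sound i old
  ... | inj₂ new with ∧-true⁻ new
  ...   | qz , adjacent with any-witness (λ y → within i y ∧ A y _) adjacent
  ...     | y , ry with ∧-true⁻ ry
  ...       | wy , ayz = connIn-snoc (within-sound i wy) ayz qz

  within-suc : ∀ i {z} → within i z ≡ true → within (suc i) z ≡ true
  within-suc i e rewrite e = refl

  Closed : ℕ → Set
  Closed i = ∀ {y z} → within i y ≡ true → A y z ≡ true → Q z ≡ true → within i z ≡ true

  growth : ℕ → Bool
  growth i = any (λ z → not (within i z) ∧ frontier (within i) z)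

  no-growth⇒stable : ∀ i → growth i ≡ false → ∀ z → within (suc i) z ≡ within i z
  no-growth⇒stable i g z with within i z in wz
  ... | true  = refl
  ... | false with any-false _ g z
  ...   | h rewrite wz = h

  no-growth⇒closed : ∀ i → growth i ≡ false → Closed (suc i)
  no-growth⇒closed i g {y} {z} wy ayz qz with within i z in wz
  ... | true  = refl
  ... | false with any-false _ g z
  ...   | h rewrite wz | qz
              | any-intro (λ y → within i y ∧ A y z) y
                  (cong₂ _∧_ (trans (sym (no-growth⇒stable i g y)) wy) ayz) = ⊥-elim (true≢false h)

  closed⇒no-frontier : ∀ {i z} → Closed i → within i z ≡ false → frontier (within i) z ≡ true → ⊥
  closed⇒no-frontier {i} {z} closed outside front with ∧-true⁻ {Q z} front
  ... | qz , adjacent with any-witness (λ y → within i y ∧ A y z) adjacent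
  ...   | y , ry with ∧-true⁻ ry
  ...     | wy , ayz = true≢false (trans (sym (closed wy ayz qz)) outside)

  closed-or-large : ∀ i → Closed i ⊎ i ≤ ∣ tabulate (within i) ∣
  closed-or-large zero = inj₂ z≤n
  closed-or-large (suc i) with Bool-cases (growth i)
  ... | inj₂ none = inj₁ (no-growth⇒closed i none)
  ... | inj₁ some with any-witness (λ z → not (within i z) ∧ frontier (within i) z) some
  ...   | z , hz with ∧-true⁻ {not (within i z)} hz
  ...     | outside , front with closed-or-large i
  ...       | inj₁ closed = ⊥-elim (closed⇒no-frontier {i} closed (not-true⁻ outside) front)
  ...       | inj₂ large  =
    inj₂ (≤-trans (s≤s large)
                  (∣tabulate∣-mono-< {b = within i} (λ _ → within-suc i) (not-true⁻ outside) found))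
    where
    found : within (suc i) z ≡ true
    found = trans (cong (_∨ frontier (within i) z) (not-true⁻ outside)) front

  -- n + 1 rounds suffice, since every round that does not close up adds a vertex.
  reachable : Fin n → Bool
  reachable = within (suc n)

  reachable-closed : Closed (suc n)
  reachable-closed with closed-or-large (suc n)
  ... | inj₁ closed = closed
  ... | inj₂ large  = ⊥-elim (<-irrefl refl (≤-trans large (∣p∣≤n (tabulate reachable))))

  reachable-sound : ∀ {z} → reachable z ≡ true → ConnIn A (In Q) u z
  reachable-sound = within-sound (suc n)

  within-start : In Q u → ∀ i → within i u ≡ true
  within-start qu zero    rewrite qu | ==-refl u = refl
  within-start qu (suc i) = within-suc i (within-start qu i)

  reachable-complete : ∀ {z} → ConnIn A (In Q) u z → reachable z ≡ true
  reachable-complete w = go w (within-start (connIn-head w) (suc n))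
    where
    go : ∀ {a z} → ConnIn A (In Q) a z → reachable a ≡ true → reachable z ≡ true
    go (here _)      r = r
    go (step _ e w′) r = go w′ (reachable-closed r e (connIn-head w′))

-- Components, cuts and bonds

module _ {n : ℕ} {A : Rel n} where

  conn-edge : ∀ {a b} → A a b ≡ true → Conn A a b
  conn-edge e = step tt e (here tt)

  conn-delete⁻ : ∀ {F : Rel n} {a b} → Conn (delete A F) a b → Conn A a b
  conn-delete⁻ = connIn-map (λ p → p) (λ _ _ e → proj₁ (∧-true⁻ e))

  componentCount-transfer : ∀ {B : Rel n} {k} →
    (∀ {a b} → Conn A a b → Conn B a b) → (∀ {a b} → Conn B a b → Conn A a b) →
    ComponentCount A k → ComponentCount B k
  componentCount-transfer A⇒B B⇒A (R , ∣R∣≡k , reps , unique) =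
    R , ∣R∣≡k , (λ v → let (r , r∈R , v~r) = reps v in r , r∈R , A⇒B v~r) ,
    (λ r r′ r∈R r′∈R r~r′ → unique r r′ r∈R r′∈R (B⇒A r~r′))

delete-sym : ∀ {n} (G : Graph n) (F : EdgeSet G) →
             ∀ u v → delete (adj G) (mem F) u v ≡ delete (adj G) (mem F) v u
delete-sym G F u v = cong₂ (λ a b → a ∧ not b) (adj-sym G u v) (memSym F u v)

removeEdge-⊆ : ∀ {n} {A : Rel n} {a b z w} → removeEdge A a b z w ≡ true →
               A z w ≡ true × ¬ (z ≡ a × w ≡ b) × ¬ (z ≡ b × w ≡ a)
removeEdge-⊆ {A = A} {a} {b} {z} {w} e with ∧-true⁻ {A z w} e
... | azw , kept = azw , (λ { (refl , refl) → true≢false (trans (sym kept) (forward a b)) })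
                       , (λ { (refl , refl) → true≢false (trans (sym kept) (backward a b)) })
  where
  forward : ∀ a b → not ((a == a ∧ b == b) ∨ (a == b ∧ b == a)) ≡ false
  forward a b rewrite ==-refl a | ==-refl b = refl
  backward : ∀ a b → not ((b == a ∧ a == b) ∨ (b == b ∧ a == a)) ≡ false
  backward a b rewrite ==-refl a | ==-refl b | ∨-zeroʳ (b == a ∧ a == b) = refl

module Components {n : ℕ} (G : Graph n) where

  private
    A = adj G
    everywhere : Fin n → Bool
    everywhere _ = true
    module R = Reachability A everywhere

  component : Fin n → Fin n → Bool
  component x = R.reachable x

  component-sound : ∀ {x z} → component x z ≡ true → Conn A x z
  component-sound {x} e = forget (R.reachable-sound x e)

  component-complete : ∀ {x z} → Conn A x z → component x z ≡ true
  component-complete {x} w = R.reachable-complete x (connIn-map (λ _ → refl) (λ _ _ e → e) w)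

  component-cong : ∀ {x y} → Conn A x y → ∀ z → component x z ≡ component y z
  component-cong x~y z = true⇔⇒≡
    (λ e → component-complete (connIn-trans (connIn-sym (adj-sym G) x~y) (component-sound e)))
    (λ e → component-complete (connIn-trans x~y (component-sound e)))

  rep : Fin n → Fin n
  rep x = fromMaybe x (first (component x))

  first-component : ∀ x → ∃ λ r → first (component x) ≡ just r
  first-component x = first-complete (component x) x (component-complete (here tt))

  rep-conn : ∀ x → Conn A x (rep x)
  rep-conn x with first-component x
  ... | r , e rewrite e = component-sound (first-sound (component x) e)

  rep-cong : ∀ {x y} → Conn A x y → rep x ≡ rep y
  rep-cong {x} {y} x~y with first-component x
  ... | r , e rewrite e | trans (first-cong (λ z → sym (component-cong x~y z))) e = refl

  rep-idem : ∀ x → rep (rep x) ≡ rep x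
  rep-idem x = sym (rep-cong (rep-conn x))

  componentCount : ∃ (ComponentCount A)
  componentCount = ∣ reps ∣ , reps , refl , (λ v → rep v , is-rep v , rep-conn v) , unique
    where
    reps : Subset n
    reps = tabulate (λ x → rep x == x)

    is-rep : ∀ v → rep v ∈ reps
    is-rep v = ∈-tabulate⁺ (trans (cong (_== rep v) (rep-idem v)) (==-refl (rep v)))

    fixed : ∀ {r} → r ∈ reps → rep r ≡ r
    fixed {r} r∈ = ==⇒≡ {x = rep r} (∈-tabulate⁻ r∈)

    unique : ∀ r r′ → r ∈ reps → r′ ∈ reps → Conn A r r′ → r ≡ r′
    unique r r′ r∈ r′∈ r~r′ = trans (sym (fixed r∈)) (trans (rep-cong r~r′) (fixed r′∈))

module Cuts {n : ℕ} (G : Graph n) (S : Fin n → Bool) where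

  private
    A = adj G

  crossing : Rel n
  crossing u v = A u v ∧ (S u xor S v)

  cut : EdgeSet G
  cut = record
    { mem    = crossing
    ; memSym = λ u v → cong₂ _∧_ (adj-sym G u v) (xor-comm (S u) (S v))
    ; memSub = λ u v e → proj₁ (∧-true⁻ e) }

  Inside Outside : Fin n → Set
  Inside  z = S z ≡ true
  Outside z = S z ≡ false

  same-side⇒¬crossing : ∀ {u v} → S u ≡ S v → crossing u v ≡ false
  same-side⇒¬crossing {u} {v} e rewrite e = trans (cong (A u v ∧_) (xor-same (S v))) (∧-zeroʳ (A u v))

  cut-separates : ∀ {a b} → Conn (delete A crossing) a b → S a ≡ S b
  cut-separates = connIn-invariant S (λ {z} {w} _ _ e → kept-edge (A z w) (S z) (S w) e)
    where
    kept-edge : ∀ a s t → a ∧ not (a ∧ (s xor t)) ≡ true → s ≡ t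
    kept-edge true true  true  _ = refl
    kept-edge true false false _ = refl

  -- The representatives of G − cut map onto those of G, and the two ends of a
  -- crossing edge have distinct representatives in G − cut but the same one in G.
  cut-disconnects : ∀ {a₀ b₀} → Inside a₀ → Outside b₀ → A a₀ b₀ ≡ true → Disconnects G cut
  cut-disconnects {a₀} {b₀} a₀-in b₀-out a₀b₀ k k′
                  (R , ∣R∣≡k , repsᴳ , uniqueᴳ) (R′ , ∣R′∣≡k′ , repsᴮ , _) =
    subst₂ _<_ ∣R∣≡k ∣R′∣≡k′
      (onto-non-injective⇒∣p∣<∣q∣ R R′ repᴳ onto (repᴮ∈R′ a₀) (repᴮ∈R′ b₀) distinct collapse)
    where
    B = delete A crossing
    ~sym : ∀ {a b} → Conn A a b → Conn A b a
    ~sym = connIn-sym (adj-sym G)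

    repᴳ repᴮ : Fin n → Fin n
    repᴳ y = proj₁ (repsᴳ y)
    repᴮ y = proj₁ (repsᴮ y)

    repᴳ∈R : ∀ y → repᴳ y ∈ R
    repᴳ∈R y = proj₁ (proj₂ (repsᴳ y))

    repᴮ∈R′ : ∀ y → repᴮ y ∈ R′
    repᴮ∈R′ y = proj₁ (proj₂ (repsᴮ y))

    ~repᴳ : ∀ y → Conn A y (repᴳ y)
    ~repᴳ y = proj₂ (proj₂ (repsᴳ y))

    ~repᴮ : ∀ y → Conn A y (repᴮ y)
    ~repᴮ y = conn-delete⁻ (proj₂ (proj₂ (repsᴮ y)))

    onto : ∀ {x} → x ∈ R → ∃ λ y → y ∈ R′ × repᴳ y ≡ x
    onto {x} x∈R = repᴮ x , repᴮ∈R′ x ,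
      uniqueᴳ _ _ (repᴳ∈R (repᴮ x)) x∈R (connIn-trans (~sym (~repᴳ (repᴮ x))) (~sym (~repᴮ x)))

    distinct : repᴮ a₀ ≢ repᴮ b₀
    distinct e = true≢false (trans (sym a₀-in) (trans (cut-separates a₀~b₀) b₀-out))
      where
      a₀~b₀ : Conn B a₀ b₀
      a₀~b₀ = connIn-trans (proj₂ (proj₂ (repsᴮ a₀)))
                (subst (λ r → Conn B r b₀) (sym e)
                  (connIn-sym (delete-sym G cut) (proj₂ (proj₂ (repsᴮ b₀)))))

    collapse : repᴳ (repᴮ a₀) ≡ repᴳ (repᴮ b₀)
    collapse = uniqueᴳ _ _ (repᴳ∈R _) (repᴳ∈R _)
      (connIn-trans (~sym (~repᴳ (repᴮ a₀))) (connIn-trans (~sym (~repᴮ a₀))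
        (connIn-trans (conn-edge a₀b₀) (connIn-trans (~repᴮ b₀) (~repᴳ (repᴮ b₀))))))

  -- Removing a proper part of the cut keeps G connected as before: a crossing edge
  -- can be rerouted through the surviving crossing edge.
  cut-minimal : (∀ {a b} → Inside a → Inside b → ConnIn A Inside a b) →
                (∀ {a b} → Outside a → Outside b → Conn A a b → ConnIn A Outside a b) →
                ∀ F′ → F′ ⊂E cut → ¬ Disconnects G F′
  cut-minimal inside-conn outside-conn F′ (F′⊆cut , u , v , cut-uv , uv∉F′) disc =
    <-irrefl refl (disc k k cc (componentCount-transfer A⇒B conn-delete⁻ cc))
    where
    open Components G using (componentCount)
    k = proj₁ componentCount
    cc = proj₂ componentCount

    B = delete A (mem F′)
    ~sym : ∀ {a b} → Conn A a b → Conn A b a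
    ~sym = connIn-sym (adj-sym G)

    ¬crossing⇒kept : ∀ {x y} → A x y ≡ true → crossing x y ≡ false → B x y ≡ true
    ¬crossing⇒kept {x} {y} axy ¬cxy with mem F′ x y in e
    ... | false = trans (∧-identityʳ (A x y)) axy
    ... | true  = ⊥-elim (true≢false (trans (sym (F′⊆cut x y e)) ¬cxy))

    side-walk : ∀ {s a b} → ConnIn A (λ z → S z ≡ s) a b → Conn B a b
    side-walk = connIn-map (λ _ → tt)
                  (λ pz pw e → ¬crossing⇒kept e (same-side⇒¬crossing (trans pz (sym pw))))

    survivor : ∃ λ p → ∃ λ q → Inside p × Outside q × B p q ≡ true
    survivor with ∧-true⁻ {A u v} cut-uv
    ... | auv , _ with S u in su | S v in sv
    ...   | true  | false = u , v , su , sv , kept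
      where kept : B u v ≡ true
            kept rewrite uv∉F′ | auv = refl
    ...   | false | true  = v , u , sv , su , kept
      where kept : B v u ≡ true
            kept rewrite EdgeSet.memSym F′ v u | uv∉F′ | adj-sym G v u | auv = refl

    crossing-edge : ∀ {x y} → Inside x → Outside y → A x y ≡ true → Conn B x y
    crossing-edge {x} {y} x-in y-out axy with survivor
    ... | p , q , p-in , q-out , bpq =
      connIn-trans (side-walk (inside-conn x-in p-in))
        (step tt bpq (side-walk (outside-conn q-out y-out q~y)))
      where
      q~y : Conn A q y
      q~y = connIn-trans (~sym (conn-edge (proj₁ (∧-true⁻ bpq))))
              (connIn-trans (forget (inside-conn p-in x-in)) (conn-edge axy))

    edge : ∀ {x y} → A x y ≡ true → Conn B x y
    edge {x} {y} axy with crossing x y in cxy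
    ... | false = conn-edge (¬crossing⇒kept axy cxy)
    ... | true with S x in sx | S y in sy
    ...   | true  | false = crossing-edge sx sy axy
    ...   | false | true  = connIn-sym (delete-sym G F′) (crossing-edge sy sx (trans (adj-sym G y x) axy))
    ...   | true  | true  = ⊥-elim (true≢false (trans (sym cxy) (∧-zeroʳ (A x y))))
    ...   | false | false = ⊥-elim (true≢false (trans (sym cxy) (∧-zeroʳ (A x y))))

    A⇒B : ∀ {a b} → Conn A a b → Conn B a b
    A⇒B = conn-edges edge

  cut-isBond : (∀ {a b} → Inside a → Inside b → ConnIn A Inside a b) →
               (∀ {a b} → Outside a → Outside b → Conn A a b → ConnIn A Outside a b) →
               ∀ {a₀ b₀} → Inside a₀ → Outside b₀ → A a₀ b₀ ≡ true → IsBond G cut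
  cut-isBond inside-conn outside-conn a₀-in b₀-out a₀b₀ =
    cut-disconnects a₀-in b₀-out a₀b₀ , cut-minimal inside-conn outside-conn

  boundary : Fin n → Bool
  boundary u = not (S u) ∧ any (λ s → S s ∧ A u s)

  outward : Rel n
  outward u v = not (S u) ∧ crossing u v

  boundary≤outward : ∀ u → 𝟙 (boundary u) ≤ ∑[ v < n ] 𝟙 (outward u v)
  boundary≤outward u with boundary u in bu
  ... | false = z≤n
  ... | true with ∧-true⁻ {not (S u)} bu
  ...   | ¬su , adjacent with any-witness (λ s → S s ∧ A u s) adjacent
  ...     | s , ss∧aus with ∧-true⁻ {S s} ss∧aus
  ...       | ss , aus = subst (_≤ _) (cong 𝟙 out) (term≤∑ (λ v → 𝟙 (outward u v)) s)
    where
    out : outward u s ≡ true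
    out rewrite not-true⁻ ¬su | ss | aus = refl

  outward-split : ∀ u v → 𝟙 (outward u v) ≤ 𝟙 (u <ᶠ v ∧ outward u v) + 𝟙 (v <ᶠ u ∧ outward u v)
  outward-split u v with outward u v in out
  ... | false = z≤n
  ... | true with <ᶠ-connex u≢v
    where
    u≢v : u ≢ v
    u≢v refl = true≢false (trans (sym (proj₁ (∧-true⁻ (proj₂ (∧-true⁻ {not (S u)} out))))) (irrefl G u))
  ...   | inj₁ u<v rewrite u<v = s≤s z≤n
  ...   | inj₂ v<u rewrite v<u = m≤n+m _ _

  outward-pair : ∀ u v → 𝟙 (u <ᶠ v ∧ outward u v) + 𝟙 (u <ᶠ v ∧ outward v u) ≤ 𝟙 (u <ᶠ v ∧ crossing u v)
  outward-pair u v rewrite adj-sym G v u = one-orientation (u <ᶠ v) (A u v) (S u) (S v)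
    where
    one-orientation : ∀ l a s t →
      𝟙 (l ∧ (not s ∧ (a ∧ (s xor t)))) + 𝟙 (l ∧ (not t ∧ (a ∧ (t xor s)))) ≤ 𝟙 (l ∧ (a ∧ (s xor t)))
    one-orientation false _     _     _     = z≤n
    one-orientation true  false true  true  = z≤n
    one-orientation true  false true  false = z≤n
    one-orientation true  false false true  = z≤n
    one-orientation true  false false false = z≤n
    one-orientation true  true  true  true  = z≤n
    one-orientation true  true  true  false = s≤s z≤n
    one-orientation true  true  false true  = s≤s z≤n
    one-orientation true  true  false false = z≤n

  -- Each boundary vertex is the outer end of a cut edge, and each cut edge has one outer end.
  ∣boundary∣≤size-cut : ∣ tabulate boundary ∣ ≤ size cut
  ∣boundary∣≤size-cut = begin
    ∣ tabulate boundary ∣                          ≡⟨ ∣tabulate∣≡∑𝟙 boundary ⟩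
    ∑[ u < n ] 𝟙 (boundary u)                      ≤⟨ ∑-mono-≤ boundary≤outward ⟩
    ∑∑ (λ u v → 𝟙 (outward u v))                   ≤⟨ ∑-mono-≤ (λ u → ∑-mono-≤ (outward-split u)) ⟩
    ∑∑ (λ u v → forward u v + backward u v)        ≡⟨ ∑∑-distrib-+ forward backward ⟩
    ∑∑ forward + ∑∑ backward                       ≡⟨ cong (∑∑ forward +_) (∑-comm backward) ⟩
    ∑∑ forward + ∑∑ (λ u v → backward v u)         ≡⟨ sym (∑∑-distrib-+ forward (λ u v → backward v u)) ⟩
    ∑∑ (λ u v → forward u v + backward v u)        ≤⟨ ∑-mono-≤ (λ u → ∑-mono-≤ (outward-pair u)) ⟩
    ∑∑ (λ u v → 𝟙 (u <ᶠ v ∧ crossing u v))         ≡⟨ sym (countRel≡∑∑ crossing) ⟩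
    size cut                                       ∎
    where
    open ≤-Reasoning
    forward backward : Fin n → Fin n → ℕ
    forward  u v = 𝟙 (u <ᶠ v ∧ outward u v)
    backward u v = 𝟙 (v <ᶠ u ∧ outward u v)

-- Normal spanning trees

module _ {n : ℕ} where

  open DecMembership (_≟_ {n}) using (_∈?_)

  _∈ᵇ_ : Fin n → List (Fin n) → Bool
  x ∈ᵇ xs = does (x ∈? xs)

  ∈ᵇ⁻ : ∀ {x xs} → x ∈ᵇ xs ≡ true → x ∈ₗ xs
  ∈ᵇ⁻ {x} {xs} e with x ∈? xs
  ... | yes x∈xs = x∈xs

  ∈ᵇ⁺ : ∀ {x xs} → x ∈ₗ xs → x ∈ᵇ xs ≡ true
  ∈ᵇ⁺ {x} {xs} = dec-true (x ∈? xs)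

  ∈ᵇ-false⁻ : ∀ {x xs} → x ∈ᵇ xs ≡ false → ¬ x ∈ₗ xs
  ∈ᵇ-false⁻ e x∈ = true≢false (trans (sym (∈ᵇ⁺ x∈)) e)

  ∉ᵇ : ∀ {x xs} → ¬ x ∈ₗ xs → x ∈ᵇ xs ≡ false
  ∉ᵇ {x} {xs} = dec-false (x ∈? xs)

  ∈ᵇ-∷-≢ : ∀ {x y ys} → x ≢ y → x ∈ᵇ (y ∷ ys) ≡ x ∈ᵇ ys
  ∈ᵇ-∷-≢ {x} {y} {ys} x≢y =
    true⇔⇒≡ (λ e → ∈ᵇ⁺ (drop (∈ᵇ⁻ {xs = y ∷ ys} e))) (λ e → ∈ᵇ⁺ {xs = y ∷ ys} (Any.there (∈ᵇ⁻ e)))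
    where
    drop : x ∈ₗ y ∷ ys → x ∈ₗ ys
    drop (Any.here x≡y) = ⊥-elim (x≢y x≡y)
    drop (Any.there x∈) = x∈

  data PathTo (A : Rel n) (r : Fin n) : List (Fin n) → Set where
    end : PathTo A r (r ∷ [])
    hop : ∀ {x y xs} → A x y ≡ true → PathTo A r (y ∷ xs) → PathTo A r (x ∷ y ∷ xs)

  pathTo-snoc : ∀ {A r s xs} → PathTo A r xs → A r s ≡ true → PathTo A s (xs ++ s ∷ [])
  pathTo-snoc end       e′ = hop e′ end
  pathTo-snoc (hop e p) e′ = hop e (pathTo-snoc p e′)

  pathTo-∈ : ∀ {A r xs} → PathTo A r xs → r ∈ₗ xs
  pathTo-∈ end       = Any.here refl
  pathTo-∈ (hop _ p) = Any.there (pathTo-∈ p)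

  pathTo-hop⁻ : ∀ {A r x y xs} → PathTo A r (x ∷ y ∷ xs) → A x y ≡ true
  pathTo-hop⁻ (hop e _) = e

  pathTo-single : ∀ {A r x} → PathTo A r (x ∷ []) → x ≡ r
  pathTo-single end = refl

  pathTo⇒connIn : ∀ {A r P x xs} → PathTo A r (x ∷ xs) → (∀ {z} → z ∈ₗ x ∷ xs → P z) → ConnIn A P x r
  pathTo⇒connIn end       ⊆P = here (⊆P (Any.here refl))
  pathTo⇒connIn (hop e p) ⊆P = step (⊆P (Any.here refl)) e (pathTo⇒connIn p (λ z∈ → ⊆P (Any.there z∈)))

-- Root paths of a normal spanning tree of G[P] rooted at r: the child of r towards x is the
-- first neighbour of r in the component of x in G[P ∖ r], and we recurse into that component.
module RootPaths {n : ℕ} (G : Graph n) where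

  private
    A = adj G
    ~sym : ∀ {P : Fin n → Set} {a b} → ConnIn A P a b → ConnIn A P b a
    ~sym = connIn-sym (adj-sym G)

  -- Kept abstract: only soundness and completeness of reach matter below.
  abstract
    reach : (Fin n → Bool) → Fin n → Fin n → Bool
    reach Q x = Reachability.reachable A Q x

    reach-sound : ∀ Q {x z} → reach Q x z ≡ true → ConnIn A (In Q) x z
    reach-sound Q {x} = Reachability.reachable-sound A Q x

    reach-complete : ∀ Q {x z} → ConnIn A (In Q) x z → reach Q x z ≡ true
    reach-complete Q {x} = Reachability.reachable-complete A Q x

  reach-cong : ∀ Q {x y} → ConnIn A (In Q) x y → ∀ z → reach Q x z ≡ reach Q y z
  reach-cong Q {x} {y} x~y z = true⇔⇒≡
    (λ e → reach-complete Q (connIn-trans (~sym x~y) (reach-sound Q {x} e)))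
    (λ e → reach-complete Q (connIn-trans x~y (reach-sound Q {y} e)))

  _∖_ : (Fin n → Bool) → Fin n → Fin n → Bool
  (P ∖ r) z = P z ∧ not (z == r)

  branch : (Fin n → Bool) → Fin n → Fin n → Fin n → Bool
  branch P r c = reach (P ∖ r) c

  attach : (Fin n → Bool) → Fin n → Fin n → Fin n → Bool
  attach P r x z = reach (P ∖ r) x z ∧ A r z

  -- The fuel bounds the size of P; when it runs out the result is junk, which the invariant excludes.
  rootPath : ℕ → (Fin n → Bool) → Fin n → Fin n → List (Fin n)
  rootPath-via : ℕ → (Fin n → Bool) → Fin n → Fin n → Maybe (Fin n) → List (Fin n)
  rootPath zero    P r x = x ∷ []
  rootPath (suc f) P r x = if x == r then r ∷ [] else rootPath-via f P r x (first (attach P r x))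
  rootPath-via f P r x nothing  = x ∷ []
  rootPath-via f P r x (just c) = rootPath f (branch P r c) c x ++ r ∷ []

  Rooted : ℕ → (Fin n → Bool) → Fin n → Set
  Rooted f P r = In P r × (∀ {x} → In P x → ConnIn A (In P) r x) × ∣ tabulate P ∣ ≤ f

  ¬Rooted-zero : ∀ {P r} → ¬ Rooted zero P r
  ¬Rooted-zero {P} (pr , _ , ∣P∣≤0) = n≮0 (≤-trans (x∈p⇒0<∣p∣ (∈-tabulate⁺ {b = P} pr)) ∣P∣≤0)

  ∖-intro : ∀ {P r z} → In P z → z ≢ r → In (P ∖ r) z
  ∖-intro {P} {r} {z} pz z≢r rewrite pz | ≢⇒==-false z≢r = refl

  ∖-elim : ∀ {P r z} → In (P ∖ r) z → In P z × z ≢ r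
  ∖-elim {P} {r} {z} e with ∧-true⁻ {P z} e
  ... | pz , z≠r = pz , ==-false⇒≢ {x = z} {r} (not-true⁻ z≠r)

  before-first-visit : ∀ {P x r} → ConnIn A (In P) x r → x ≢ r →
                       ∃ λ z → ConnIn A (In (P ∖ r)) x z × A z r ≡ true
  before-first-visit (here _) x≢r = ⊥-elim (x≢r refl)
  before-first-visit {P} {x} {r} (step {w = w} px e w~r) x≢r with w == r in w==r
  ... | true  = x , here (∖-intro {P} px x≢r) , subst (λ v → A x v ≡ true) (==⇒≡ {x = w} w==r) e
  ... | false with before-first-visit w~r (==-false⇒≢ {x = w} w==r)
  ...   | z , w~z , azr = z , step (∖-intro {P} px x≢r) e w~z , azr

  record Descent (f : ℕ) (P : Fin n → Bool) (r x : Fin n) : Set where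
    field
      child          : Fin n
      first-attach   : first (attach P r x) ≡ just child
      child-rooted   : Rooted f (branch P r child) child
      x∈branch       : In (branch P r child) x
      child-adj-root : A child r ≡ true
      branch⊆        : ∀ {z} → In (branch P r child) z → In (P ∖ r) z
      attach-cong    : ∀ {y} → In (branch P r child) y → ∀ z → attach P r y z ≡ attach P r x z

  descent : ∀ {f P r x} → Rooted (suc f) P r → In P x → x ≢ r → Descent f P r x
  descent {f} {P} {r} {x} (pr , r~ , ∣P∣≤1+f) px x≢r = record
    { child          = c
    ; first-attach   = first-attach
    ; child-rooted   = child-rooted
    ; x∈branch       = reach-complete Q (~sym x~c)
    ; child-adj-root = trans (adj-sym G c r) (proj₂ attach-c)
    ; branch⊆        = branch⊆
    ; attach-cong    = λ {y} y∈C z →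
        cong (_∧ A r z) (reach-cong Q (connIn-trans (~sym (reach-sound Q y∈C)) (~sym x~c)) z)
    }
    where
    Q = P ∖ r
    hit = before-first-visit (~sym (r~ px)) x≢r
    z₀ = proj₁ hit

    attach-z₀ : attach P r x z₀ ≡ true
    attach-z₀ rewrite reach-complete Q (proj₁ (proj₂ hit)) | adj-sym G r z₀ = proj₂ (proj₂ hit)

    c = proj₁ (first-complete (attach P r x) z₀ attach-z₀)
    first-attach = proj₂ (first-complete (attach P r x) z₀ attach-z₀)
    attach-c = ∧-true⁻ {reach Q x c} (first-sound (attach P r x) first-attach)

    x~c : ConnIn A (In Q) x c
    x~c = reach-sound Q (proj₁ attach-c)

    C = branch P r c

    branch⊆ : ∀ {z} → In C z → In Q z
    branch⊆ z∈C = connIn-last (reach-sound Q z∈C)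

    r∉C : C r ≡ false
    r∉C with Bool-cases (C r)
    ... | inj₁ r∈C = ⊥-elim (proj₂ (∖-elim {P} (branch⊆ r∈C)) refl)
    ... | inj₂ r∉C = r∉C

    child-rooted : Rooted f C c
    child-rooted =
      reach-complete Q (here (connIn-last x~c)) ,
      (λ z∈C → connIn-map (reach-complete Q) (λ _ _ e → e) (connIn-prefixes (reach-sound Q z∈C))) ,
      s≤s⁻¹ (≤-trans (∣tabulate∣-mono-< {b = C} {c = P} (λ _ z∈C → proj₁ (∖-elim {P} (branch⊆ z∈C))) r∉C pr)
                     ∣P∣≤1+f)

  open Descent

  WalkIn : (Fin n → Bool) → Fin n → List (Fin n) → Set
  WalkIn P r xs = PathTo A r xs × (∀ {z} → z ∈ₗ xs → In P z)

  rootPath-root : ∀ f P r → rootPath f P r r ≡ r ∷ []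
  rootPath-root zero    P r = refl
  rootPath-root (suc f) P r rewrite ==-refl r = refl

  rootPath-head : ∀ f P r x → ∃ λ t → rootPath f P r x ≡ x ∷ t
  rootPath-head zero    P r x = [] , refl
  rootPath-head (suc f) P r x with x == r in x==r
  ... | true rewrite ==⇒≡ {x = x} x==r = [] , refl
  ... | false with first (attach P r x)
  ...   | nothing = [] , refl
  ...   | just c with rootPath-head f (branch P r c) c x
  ...     | t , e rewrite e = t ++ r ∷ [] , refl

  descend : ∀ {f P r x y} (d : Descent f P r x) → In (branch P r (child d)) y →
            rootPath (suc f) P r y ≡ rootPath f (branch P r (child d)) (child d) y ++ r ∷ []
  descend {f} {P} {r} {x} {y} d y∈C
    rewrite ≢⇒==-false (proj₂ (∖-elim {P} (branch⊆ d y∈C)))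
          | trans (first-cong (attach-cong d y∈C)) (first-attach d) = refl

  rootPath-walk : ∀ {f P r x} → Rooted f P r → In P x → WalkIn P r (rootPath f P r x)
  rootPath-walk {zero} rooted _ = ⊥-elim (¬Rooted-zero rooted)
  rootPath-walk {suc f} {P} {r} {x} rooted px with Bool-cases (x == r)
  ... | inj₁ x==r rewrite x==r = end , λ { (Any.here refl) → proj₁ rooted }
  ... | inj₂ x≠r = subst (WalkIn P r) (sym (descend d (x∈branch d)))
                          (extend (rootPath-walk (child-rooted d) (x∈branch d)))
    where
    d = descent rooted px (==-false⇒≢ {x = x} x≠r)
    extend : ∀ {xs} → WalkIn (branch P r (child d)) (child d) xs → WalkIn P r (xs ++ r ∷ [])
    extend (p , ⊆C) = pathTo-snoc p (child-adj-root d) , λ z∈ → case-++ (∈-++⁻ _ z∈)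
      where
      case-++ : ∀ {z} → z ∈ₗ _ ⊎ z ∈ₗ r ∷ [] → In P z
      case-++ (inj₁ z∈xs)            = proj₁ (∖-elim {P} (branch⊆ d (⊆C z∈xs)))
      case-++ (inj₂ (Any.here refl)) = proj₁ rooted

  rootPath-tail : ∀ {f P r x y rest} → Rooted f P r → In P x →
                  rootPath f P r x ≡ x ∷ y ∷ rest → rootPath f P r y ≡ y ∷ rest
  rootPath-tail {zero} rooted _ _ = ⊥-elim (¬Rooted-zero rooted)
  rootPath-tail {suc f} {P} {r} {x} {y} {rest} rooted px e with Bool-cases (x == r)
  ... | inj₁ x==r rewrite x==r with e
  ...   | ()
  rootPath-tail {suc f} {P} {r} {x} {y} {rest} rooted px e | inj₂ x≠r =
    go (rootPath-head f C c x) (trans (sym (descend d (x∈branch d))) e)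
    where
    d = descent rooted px (==-false⇒≢ {x = x} x≠r)
    c = child d
    C = branch P r c
    go : (∃ λ t → rootPath f C c x ≡ x ∷ t) → rootPath f C c x ++ r ∷ [] ≡ x ∷ y ∷ rest →
         rootPath (suc f) P r y ≡ y ∷ rest
    go ([] , h) e′ with trans (cong (_++ r ∷ []) (sym h)) e′
    ... | refl = rootPath-root (suc f) P r
    go (t ∷ ts , h) e′ with trans (cong (_++ r ∷ []) (sym h)) e′
    ... | refl = trans (descend d y∈C) (cong (_++ r ∷ []) (rootPath-tail (child-rooted d) (x∈branch d) h))
      where
      y∈C : In C y
      y∈C = proj₂ (rootPath-walk (child-rooted d) (x∈branch d))
                  (subst (y ∈ₗ_) (sym h) (Any.there (Any.here refl)))

  rootPath-normal : ∀ {f P r x y} → Rooted f P r → In P x → In P y → A x y ≡ true →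
                    x ∈ₗ rootPath f P r y ⊎ y ∈ₗ rootPath f P r x
  rootPath-normal {zero} rooted _ _ _ = ⊥-elim (¬Rooted-zero rooted)
  rootPath-normal {suc f} {P} {r} {x} {y} rooted px py axy with Bool-cases (x == r) | Bool-cases (y == r)
  ... | inj₁ x==r | _ rewrite ==⇒≡ {x = x} x==r = inj₁ (pathTo-∈ (proj₁ (rootPath-walk rooted py)))
  ... | inj₂ _ | inj₁ y==r rewrite ==⇒≡ {x = y} y==r = inj₂ (pathTo-∈ (proj₁ (rootPath-walk rooted px)))
  ... | inj₂ x≠r | inj₂ y≠r = via-child (descent rooted px (==-false⇒≢ {x = x} x≠r))
    where
    via-child : Descent f P r x → x ∈ₗ rootPath (suc f) P r y ⊎ y ∈ₗ rootPath (suc f) P r x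
    via-child d = Sum.map (λ x∈ → subst (x ∈ₗ_) (sym (descend d y∈C)) (∈-++⁺ˡ x∈))
                      (λ y∈ → subst (y ∈ₗ_) (sym (descend d (x∈branch d))) (∈-++⁺ˡ y∈))
                      (rootPath-normal (child-rooted d) (x∈branch d) y∈C axy)
      where
      y∈C : In (branch P r (child d)) y
      y∈C = reach-complete (P ∖ r)
        (connIn-snoc (reach-sound (P ∖ r) (x∈branch d)) axy (∖-intro {P} py (==-false⇒≢ {x = y} y≠r)))

-- path x lists x and its ancestors, ending at the root.
record NormalTree {n : ℕ} (G : Graph n) : Set where
  field
    root             : Fin n
    path             : Fin n → List (Fin n)
    path-head        : ∀ x → ∃ λ t → path x ≡ x ∷ t
    path-tail        : ∀ {x y rest} → path x ≡ x ∷ y ∷ rest → path y ≡ y ∷ rest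
    path-root        : path root ≡ root ∷ []
    root∈path        : ∀ x → root ∈ₗ path x
    path-edge        : ∀ {x y rest} → path x ≡ x ∷ y ∷ rest → adj G x y ≡ true ⊎ y ≡ root
    normal           : ∀ {x y} → adj G x y ≡ true → x ∈ₗ path y ⊎ y ∈ₗ path x
    conn-along-paths : ∀ {a b} → Conn (adj G) a b →
                       ConnIn (adj G) (λ z → z ∈ₗ path a ⊎ z ∈ₗ path b) a b

module NormalTreeOf {n : ℕ} (G : Graph n) (u₀ : Fin n) where

  open Components G
  open RootPaths G

  private
    A = adj G

  ρ : Fin n
  ρ = rep u₀

  rooted-component : ∀ r → Rooted n (component r) r
  rooted-component r =
    component-complete (here tt) ,
    (λ r~x → connIn-map component-complete (λ _ _ e → e) (connIn-prefixes (component-sound r~x))) ,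
    ∣p∣≤n (tabulate (component r))

  in-own-component : ∀ x → In (component (rep x)) x
  in-own-component x = component-complete (connIn-sym (adj-sym G) (rep-conn x))

  local : Fin n → List (Fin n)
  local x = rootPath n (component (rep x)) (rep x) x

  local-walk : ∀ x → WalkIn (component (rep x)) (rep x) (local x)
  local-walk x = rootPath-walk (rooted-component (rep x)) (in-own-component x)

  local-conn : ∀ {x z} → z ∈ₗ local x → Conn A x z
  local-conn {x} z∈ = connIn-trans (rep-conn x) (component-sound (proj₂ (local-walk x) z∈))

  link-from : Fin n → List (Fin n)
  link-from r = if r == ρ then [] else ρ ∷ []

  link : Fin n → List (Fin n)
  link x = link-from (rep x)

  path : Fin n → List (Fin n)
  path x = local x ++ link x

  link-cons : ∀ {x y rest} → link x ≡ y ∷ rest → y ≡ ρ × rest ≡ []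
  link-cons {x} e with rep x == ρ
  link-cons refl | false = refl , refl

  path-head : ∀ x → ∃ λ t → path x ≡ x ∷ t
  path-head x with rootPath-head n (component (rep x)) (rep x) x
  ... | t , e = t ++ link x , cong (_++ link x) e

  rep-ρ : rep ρ ≡ ρ
  rep-ρ = rep-idem u₀

  path-root : path ρ ≡ ρ ∷ []
  path-root rewrite rep-ρ | rootPath-root n (component ρ) ρ | ==-refl ρ = refl

  root∈path : ∀ x → ρ ∈ₗ path x
  root∈path x with rep x == ρ in e
  ... | true  = ∈-++⁺ˡ (subst (_∈ₗ local x) (==⇒≡ {x = rep x} e) (pathTo-∈ (proj₁ (local-walk x))))
  ... | false = ∈-++⁺ʳ (local x) (Any.here refl)

  path-tail-edge : ∀ {x y rest} → path x ≡ x ∷ y ∷ rest → (A x y ≡ true ⊎ y ≡ ρ) × path y ≡ y ∷ rest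
  path-tail-edge {x} {y} {rest} e with rootPath-head n (component (rep x)) (rep x) x
  ... | [] , h = to-root (link-cons (∷-injectiveʳ (trans (cong (_++ link x) (sym h)) e)))
    where
    to-root : y ≡ ρ × rest ≡ [] → (A x y ≡ true ⊎ y ≡ ρ) × path y ≡ y ∷ rest
    to-root (refl , refl) = inj₂ refl , path-root
  ... | z ∷ t , h with trans (cong (_++ link x) (sym h)) e
  ...   | refl = inj₁ (pathTo-hop⁻ (subst (PathTo A (rep x)) h (proj₁ (local-walk x)))) ,
                 cong₂ _++_ local-y (cong link-from same-rep)
    where
    same-rep : rep y ≡ rep x
    same-rep = sym (rep-cong (local-conn (subst (y ∈ₗ_) (sym h) (Any.there (Any.here refl)))))
    local-y : local y ≡ y ∷ t
    local-y = trans (cong (λ q → rootPath n (component q) q y) same-rep)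
                    (rootPath-tail (rooted-component (rep x)) (in-own-component x) h)

  normal : ∀ {x y} → A x y ≡ true → x ∈ₗ path y ⊎ y ∈ₗ path x
  normal {x} {y} axy =
    Sum.map (λ x∈ → ∈-++⁺ˡ (subst (λ q → x ∈ₗ rootPath n (component q) q y) same-rep x∈)) ∈-++⁺ˡ
      (rootPath-normal (rooted-component (rep x)) (in-own-component x) y∈ axy)
    where
    same-rep : rep x ≡ rep y
    same-rep = rep-cong (conn-edge axy)
    y∈ : In (component (rep x)) y
    y∈ = subst (λ q → In (component q) y) (sym same-rep) (in-own-component y)

  up-local : ∀ {Q : Fin n → Set} x → (∀ {z} → z ∈ₗ path x → Q z) → ConnIn A Q x (rep x)
  up-local x ⊆Q with rootPath-head n (component (rep x)) (rep x) x
  ... | t , h = pathTo⇒connIn (subst (PathTo A (rep x)) h (proj₁ (local-walk x)))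
                  (λ z∈ → ⊆Q (∈-++⁺ˡ (subst (_ ∈ₗ_) (sym h) z∈)))

  conn-along-paths : ∀ {a b} → Conn A a b → ConnIn A (λ z → z ∈ₗ path a ⊎ z ∈ₗ path b) a b
  conn-along-paths {a} {b} a~b =
    connIn-trans (up-local a inj₁)
      (subst (λ r → ConnIn A On r b) (sym (rep-cong a~b)) (connIn-sym (adj-sym G) (up-local b inj₂)))
    where
    On : Fin n → Set
    On z = z ∈ₗ path a ⊎ z ∈ₗ path b

normalTree : ∀ {n} (G : Graph n) → Fin n → NormalTree G
normalTree G u₀ = record
  { root             = ρ
  ; path             = path
  ; path-head        = path-head
  ; path-tail        = λ e → proj₂ (path-tail-edge e)
  ; path-root        = path-root
  ; root∈path        = root∈path
  ; path-edge        = λ e → proj₁ (path-tail-edge e)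
  ; normal           = normal
  ; conn-along-paths = conn-along-paths
  }
  where open NormalTreeOf G u₀

module TreeOrder {n : ℕ} {G : Graph n} (N : NormalTree G) where

  open NormalTree N

  -- x ⊑ y : x is an ancestor of y (or y itself).
  _⊑_ : Fin n → Fin n → Set
  x ⊑ y = x ∈ₗ path y

  path-head-≡ : ∀ {x y l} → path x ≡ y ∷ l → y ≡ x
  path-head-≡ {x} e = ∷-injectiveˡ (trans (sym e) (proj₂ (path-head x)))

  ⊑-refl : ∀ x → x ⊑ x
  ⊑-refl x = subst (x ∈ₗ_) (sym (proj₂ (path-head x))) (Any.here refl)

  ⊑-suffix : ∀ {z x} → z ⊑ x → ∃ λ pre → path x ≡ pre ++ path z
  ⊑-suffix {z} {x} z⊑x = go (path x) x refl z⊑x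
    where
    go : ∀ l x → path x ≡ l → z ∈ₗ l → ∃ λ pre → l ≡ pre ++ path z
    go (x′ ∷ l) x e z∈ with path-head-≡ e
    go (x ∷ l) x e (Any.here refl) | refl = [] , sym e
    go (x ∷ y ∷ l) x e (Any.there z∈) | refl with go (y ∷ l) y (path-tail e) z∈
    ... | pre , e′ = x ∷ pre , cong (x ∷_) e′

  ⊑-trans : ∀ {w z x} → w ⊑ z → z ⊑ x → w ⊑ x
  ⊑-trans {w} w⊑z z⊑x with ⊑-suffix z⊑x
  ... | pre , e = subst (w ∈ₗ_) (sym e) (∈-++⁺ʳ pre w⊑z)

  ⊑-antisym : ∀ {x y} → x ⊑ y → y ⊑ x → x ≡ y
  ⊑-antisym {x} {y} x⊑y y⊑x with ⊑-suffix x⊑y | ⊑-suffix y⊑x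
  ... | [] , e | _ = path-head-≡ (trans e (proj₂ (path-head x)))
  ... | p ∷ pre , e | pre′ , e′ = ⊥-elim (<-irrefl refl (≤-trans longer shorter))
    where
    length-suffix : ∀ {u v} pre → path u ≡ pre ++ path v → length (path u) ≡ length pre + length (path v)
    length-suffix pre e = trans (cong length e) (length-++ pre)
    longer : suc (length (path x)) ≤ length (path y)
    longer = subst (suc (length (path x)) ≤_) (sym (length-suffix (p ∷ pre) e)) (s≤s (m≤n+m _ _))
    shorter : length (path y) ≤ length (path x)
    shorter = subst (length (path y) ≤_) (sym (length-suffix pre′ e′)) (m≤n+m _ _)

  next-or : List (Fin n) → Fin n → Fin n
  next-or (_ ∷ y ∷ _) _ = y
  next-or _           d = d

  parent : Fin n → Fin n
  parent x = next-or (path x) x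

  parent-path : ∀ {x y rest} → path x ≡ x ∷ y ∷ rest → parent x ≡ y
  parent-path {x} e = cong (λ l → next-or l x) e

  parent-≢ : ∀ {x y rest} → path x ≡ x ∷ y ∷ rest → x ≢ y
  parent-≢ e refl = 1+n≢n (sym (cong length (∷-injectiveʳ (trans (sym (path-tail e)) e))))

  path-parent : ∀ {x} → x ≢ parent x → path x ≡ x ∷ path (parent x)
  path-parent {x} x≢p with path x in e
  ... | []         = case trans (sym e) (proj₂ (path-head x)) of λ ()
  ... | x′ ∷ []    = ⊥-elim (x≢p refl)
  ... | x′ ∷ y ∷ l with path-head-≡ e
  ...   | refl = cong (x ∷_) (sym (path-tail e))

  climb : ∀ {R : Rel n} {P : Fin n → Set} {z x} → z ⊑ x →
          (∀ {u} → z ⊑ u → u ⊑ x → P u) →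
          (∀ {u} → z ⊑ u → u ⊑ x → u ≢ z → R u (parent u) ≡ true) →
          ConnIn R P x z
  climb {R} {P} {z} {x} z⊑x onP edge = go (path x) x refl z⊑x (⊑-refl x)
    where
    go : ∀ l u → path u ≡ l → z ∈ₗ l → u ⊑ x → ConnIn R P u z
    go l u e z∈l u⊑x with u ≟ z
    ... | yes refl = here (onP (⊑-refl u) u⊑x)
    go (_ ∷ []) u e (Any.here refl) u⊑x | no u≢z = ⊥-elim (u≢z (sym (path-head-≡ e)))
    go (_ ∷ y ∷ l) u e z∈l u⊑x | no u≢z with path-head-≡ e
    go (_ ∷ y ∷ l) u e (Any.here refl) u⊑x | no u≢z | refl = ⊥-elim (u≢z refl)
    go (_ ∷ y ∷ l) u e (Any.there z∈) u⊑x | no u≢z | refl =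
      step (onP z⊑u u⊑x) (subst (λ p → R u p ≡ true) (parent-path e) (edge z⊑u u⊑x u≢z))
           (go (y ∷ l) y (path-tail e) z∈ (⊑-trans y⊑u u⊑x))
      where
      z⊑u : z ⊑ u
      z⊑u = subst (z ∈ₗ_) (sym e) (Any.there z∈)
      y⊑u : y ⊑ u
      y⊑u = subst (y ∈ₗ_) (sym e) (Any.there (Any.here refl))

  parent-of : Rel n
  parent-of u v = (parent u == v) ∧ not (u == v)

  treeAdj : Rel n
  treeAdj u v = parent-of u v ∨ parent-of v u

  treeAdj-intro : ∀ {u v} → parent u ≡ v → u ≢ v → treeAdj u v ≡ true
  treeAdj-intro {u} {v} refl u≢v rewrite ==-refl (parent u) | ≢⇒==-false u≢v = refl

  treeAdj-cases : ∀ {u v} → treeAdj u v ≡ true → (parent u ≡ v × u ≢ v) ⊎ (parent v ≡ u × v ≢ u)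
  treeAdj-cases {u} {v} e with ∨-true⁻ {parent-of u v} e
  ... | inj₁ p = let (a , b) = ∧-true⁻ {parent u == v} p in
                 inj₁ (==⇒≡ {x = parent u} a , ==-false⇒≢ {x = u} (not-true⁻ b))
  ... | inj₂ p = let (a , b) = ∧-true⁻ {parent v == u} p in
                 inj₂ (==⇒≡ {x = parent v} a , ==-false⇒≢ {x = v} (not-true⁻ b))

  treeGraph : Graph n
  treeGraph = record
    { adj    = treeAdj
    ; sym    = λ u v → ∨-comm (parent-of u v) (parent-of v u)
    ; irrefl = treeAdj-irrefl }
    where
    treeAdj-irrefl : ∀ u → treeAdj u u ≡ false
    treeAdj-irrefl u rewrite ==-refl u | ∧-zeroʳ (parent u == u) = refl

  step-up : ∀ {z u} → z ⊑ u → u ≢ z → u ≢ parent u × z ⊑ parent u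
  step-up {z} {u} z⊑u u≢z with path u in e
  ... | []         = case trans (sym e) (proj₂ (path-head u)) of λ ()
  ... | _ ∷ []     with z⊑u
  ...   | Any.here refl = ⊥-elim (u≢z (sym (path-head-≡ e)))
  step-up {z} {u} z⊑u u≢z | _ ∷ y ∷ l with path-head-≡ e | z⊑u
  ... | refl | Any.here refl = ⊥-elim (u≢z refl)
  ... | refl | Any.there z∈ = parent-≢ e , subst (z ∈ₗ_) (sym (path-tail e)) z∈

  below : Fin n → Fin n → Bool
  below t z = t ∈ᵇ path z

  below-self : ∀ t → below t t ≡ true
  below-self t = ∈ᵇ⁺ (⊑-refl t)

  not-below-parent : ∀ {t} → t ≢ parent t → below t (parent t) ≡ false
  not-below-parent {t} t≢p = ∉ᵇ (λ t⊑p → t≢p (⊑-antisym t⊑p p⊑t))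
    where
    p⊑t : parent t ⊑ t
    p⊑t = subst (parent t ∈ₗ_) (sym (path-parent t≢p)) (Any.there (⊑-refl (parent t)))

  -- Only the edge from t to its parent changes whether a vertex lies below t.
  below-invariant : ∀ {t} {R : Rel n} →
    (∀ {z w} → R z w ≡ true → treeAdj z w ≡ true × ¬ (z ≡ t × w ≡ parent t) × ¬ (z ≡ parent t × w ≡ t)) →
    ∀ {z w} → Conn R z w → below t z ≡ below t w
  below-invariant {t} R⊆ = connIn-invariant (below t) (λ _ _ e → edge (R⊆ e))
    where
    up : ∀ {c} → c ≢ parent c → t ≢ c → below t c ≡ below t (parent c)
    up {c} c≢p t≢c = trans (cong (t ∈ᵇ_) (path-parent c≢p)) (∈ᵇ-∷-≢ {ys = path (parent c)} t≢c)

    edge : ∀ {z w} → treeAdj z w ≡ true × ¬ (z ≡ t × w ≡ parent t) × ¬ (z ≡ parent t × w ≡ t) →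
           below t z ≡ below t w
    edge (zw , ex₁ , ex₂) with treeAdj-cases zw
    ... | inj₁ (refl , z≢w) = up z≢w (λ { refl → ex₁ (refl , refl) })
    ... | inj₂ (refl , w≢z) = sym (up w≢z (λ { refl → ex₂ (refl , refl) }))

  treeGraph-isTree : IsTree treeGraph
  treeGraph-isTree = nonempty root , tree-connected , no-bridge
    where
    nonempty : ∀ {m} → Fin m → 1 ≤ m
    nonempty zero    = s≤s z≤n
    nonempty (suc _) = s≤s z≤n

    to-root : ∀ x → Conn treeAdj x root
    to-root x = climb (root∈path x) (λ _ _ → tt)
                  (λ z⊑u _ u≢z → treeAdj-intro refl (proj₁ (step-up z⊑u u≢z)))

    tree-connected : ∀ u v → Conn treeAdj u v
    tree-connected u v = connIn-trans (to-root u) (connIn-sym (Graph.sym treeGraph) (to-root v))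

    no-bridge : ∀ u v → treeAdj u v ≡ true → ¬ Conn (removeEdge treeAdj u v) u v
    no-bridge u v uv u~v with treeAdj-cases uv
    ... | inj₁ (refl , u≢v) =
      true≢false (trans (sym (below-self u)) (trans (below-invariant removed u~v) (not-below-parent u≢v)))
      where
      removed : ∀ {z w} → removeEdge treeAdj u (parent u) z w ≡ true →
                treeAdj z w ≡ true × ¬ (z ≡ u × w ≡ parent u) × ¬ (z ≡ parent u × w ≡ u)
      removed = removeEdge-⊆ {A = treeAdj}
    ... | inj₂ (refl , v≢u) =
      true≢false (trans (sym (below-self v))
                        (trans (sym (below-invariant swapped u~v)) (not-below-parent v≢u)))
      where
      swapped : ∀ {z w} → removeEdge treeAdj (parent v) v z w ≡ true →
                treeAdj z w ≡ true × ¬ (z ≡ v × w ≡ parent v) × ¬ (z ≡ parent v × w ≡ v)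
      swapped e = let (zw , ex₁ , ex₂) = removeEdge-⊆ {A = treeAdj} e in zw , ex₂ , ex₁

  ⊑-linear : ∀ {u t s} → u ⊑ s → t ⊑ s → u ⊑ t ⊎ t ⊑ u
  ⊑-linear {u} {t} u⊑s t⊑s with ⊑-suffix u⊑s | ⊑-suffix t⊑s
  ... | pre , e | pre′ , e′ with ++-suffixes pre pre′ (trans (sym e) e′)
    where
    ++-suffixes : ∀ {xs ys : List (Fin n)} pre pre′ → pre ++ xs ≡ pre′ ++ ys →
                  (∃ λ q → xs ≡ q ++ ys) ⊎ (∃ λ q → ys ≡ q ++ xs)
    ++-suffixes []        pre′       e = inj₁ (pre′ , e)
    ++-suffixes (p ∷ pre) []         e = inj₂ (p ∷ pre , sym e)
    ++-suffixes (p ∷ pre) (p′ ∷ pre′) e = ++-suffixes pre pre′ (∷-injectiveʳ e)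
  ...   | inj₁ (q , e″) = inj₂ (subst (t ∈ₗ_) (sym e″) (∈-++⁺ʳ q (⊑-refl t)))
  ...   | inj₂ (q , e″) = inj₁ (subst (u ∈ₗ_) (sym e″) (∈-++⁺ʳ q (⊑-refl u)))

  ⊑-root : ∀ {t} → t ⊑ root → t ≡ root
  ⊑-root t⊑root with subst (_ ∈ₗ_) path-root t⊑root
  ... | Any.here t≡root = t≡root

  parent-step : ∀ {u} → u ≢ parent u → adj G u (parent u) ≡ true ⊎ parent u ≡ root
  parent-step {u} u≢p with path-head (parent u)
  ... | t , e = path-edge (trans (path-parent u≢p) (cong (u ∷_) e))

-- The tree-decomposition

module Decomposition {n : ℕ} {G : Graph n} (N : NormalTree G) where

  open NormalTree N
  open TreeOrder N

  private
    A = adj G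
    module Below (t : Fin n) = Cuts G (below t)

  bags : Fin n → Subset n
  bags t = ⁅ t ⁆ ∪ tabulate (Below.boundary t)

  t∈bags : ∀ t → t ∈ bags t
  t∈bags t = x∈p∪q⁺ (inj₁ (x∈⁅x⁆ t))

  boundary⁻ : ∀ {t u} → Below.boundary t u ≡ true → ¬ t ⊑ u × ∃ λ s → t ⊑ s × A u s ≡ true
  boundary⁻ {t} {u} b with ∧-true⁻ {not (below t u)} b
  ... | ¬t⊑u , adjacent with any-witness (λ s → below t s ∧ A u s) adjacent
  ...   | s , t⊑s∧us with ∧-true⁻ {below t s} t⊑s∧us
  ...     | t⊑s , us = ∈ᵇ-false⁻ (not-true⁻ ¬t⊑u) , s , ∈ᵇ⁻ t⊑s , us

  boundary⁺ : ∀ {t u s} → ¬ t ⊑ u → t ⊑ s → A u s ≡ true → Below.boundary t u ≡ true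
  boundary⁺ {t} {u} {s} ¬t⊑u t⊑s us
    rewrite ∉ᵇ ¬t⊑u | any-intro (λ s → below t s ∧ A u s) s (cong₂ _∧_ (∈ᵇ⁺ t⊑s) us) = refl

  boundary⊑ : ∀ {t u} → Below.boundary t u ≡ true → u ⊑ t
  boundary⊑ b with boundary⁻ b
  ... | ¬t⊑u , s , t⊑s , us with normal us
  ...   | inj₂ s⊑u = ⊥-elim (¬t⊑u (⊑-trans t⊑s s⊑u))
  ...   | inj₁ u⊑s with ⊑-linear u⊑s t⊑s
  ...     | inj₁ u⊑t = u⊑t
  ...     | inj₂ t⊑u = ⊥-elim (¬t⊑u t⊑u)

  boundary-up : ∀ {t u v} → Below.boundary t u ≡ true → u ⊑ v → v ⊑ t → u ∈ bags v
  boundary-up {t} {u} {v} b u⊑v v⊑t with u ≟ v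
  ... | yes refl = t∈bags u
  ... | no u≢v with boundary⁻ b
  ...   | ¬t⊑u , s , t⊑s , us =
    x∈p∪q⁺ (inj₂ (∈-tabulate⁺ (boundary⁺ (λ v⊑u → u≢v (⊑-antisym u⊑v v⊑u)) (⊑-trans v⊑t t⊑s) us)))

  ancestor-in-bag : ∀ {x y} → A x y ≡ true → x ⊑ y → x ∈ bags y
  ancestor-in-bag {x} {y} xy x⊑y = x∈p∪q⁺ (inj₂ (∈-tabulate⁺ (boundary⁺ ¬y⊑x (⊑-refl y) xy)))
    where
    ¬y⊑x : ¬ y ⊑ x
    ¬y⊑x y⊑x with ⊑-antisym x⊑y y⊑x
    ... | refl = true≢false (trans (sym xy) (irrefl G x))

  bags-cover : ∀ x y → A x y ≡ true → ∃ λ t → x ∈ bags t × y ∈ bags t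
  bags-cover x y xy with normal xy
  ... | inj₁ x⊑y = y , ancestor-in-bag xy x⊑y , t∈bags y
  ... | inj₂ y⊑x = x , t∈bags x , ancestor-in-bag (trans (adj-sym G y x) xy) y⊑x

  up-to-vertex : ∀ {x t} → x ∈ bags t → ConnIn treeAdj (λ s → x ∈ bags s) t x
  up-to-vertex {x} {t} x∈ with x∈p∪q⁻ ⁅ t ⁆ _ x∈
  ... | inj₁ x∈⁅t⁆ rewrite x∈⁅y⁆⇒x≡y t x∈⁅t⁆ = here x∈
  ... | inj₂ x∈∂ = climb (boundary⊑ b) (λ x⊑v v⊑t → boundary-up b x⊑v v⊑t)
                     (λ x⊑v _ v≢x → treeAdj-intro refl (proj₁ (step-up x⊑v v≢x)))
    where
    b = ∈-tabulate⁻ x∈∂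

  decomposition : TreeDecomposition G
  decomposition = record
    { m         = n
    ; tree      = treeGraph
    ; isTree    = treeGraph-isTree
    ; bag       = bags
    ; nonEmpty  = λ x → x , t∈bags x
    ; connected = λ x t t′ x∈t x∈t′ →
        connIn-trans (up-to-vertex x∈t) (connIn-sym (Graph.sym treeGraph) (up-to-vertex x∈t′))
    ; covers    = bags-cover
    }

  module _ (t : Fin n) where
    open Below t using (Inside; Outside; boundary; cut; cut-isBond; ∣boundary∣≤size-cut)

    inside-connected : t ≢ root → ∀ {a b} → Inside a → Inside b → ConnIn A Inside a b
    inside-connected t≢root a-in b-in = connIn-trans (down a-in) (connIn-sym (adj-sym G) (down b-in))
      where
      edge : ∀ {v} → t ⊑ v → v ≢ t → A v (parent v) ≡ true
      edge t⊑v v≢t with step-up t⊑v v≢t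
      ... | v≢p , t⊑p with parent-step v≢p
      ...   | inj₁ e    = e
      ...   | inj₂ p≡root = ⊥-elim (t≢root (⊑-root (subst (t ⊑_) p≡root t⊑p)))
      down : ∀ {a} → Inside a → ConnIn A Inside a t
      down a-in = climb (∈ᵇ⁻ a-in) (λ t⊑v _ → ∈ᵇ⁺ t⊑v) (λ t⊑v _ v≢t → edge t⊑v v≢t)

    outside-connected : ∀ {a b} → Outside a → Outside b → Conn A a b → ConnIn A Outside a b
    outside-connected {a} {b} a-out b-out a~b = connIn-map outside (λ _ _ e → e) (conn-along-paths a~b)
      where
      outside : ∀ {z} → z ⊑ a ⊎ z ⊑ b → Outside z
      outside (inj₁ z⊑a) = ∉ᵇ (λ t⊑z → ∈ᵇ-false⁻ a-out (⊑-trans t⊑z z⊑a))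
      outside (inj₂ z⊑b) = ∉ᵇ (λ t⊑z → ∈ᵇ-false⁻ b-out (⊑-trans t⊑z z⊑b))

    ∣boundary∣≤ : ∀ {c} → (∀ F → IsBond G F → size F ≤ c) → ∣ tabulate boundary ∣ ≤ c
    ∣boundary∣≤ bonds≤c with nonempty? (tabulate boundary)
    ... | no  empty = subst (_≤ _) (sym (trans (cong ∣_∣ (Empty-unique empty)) (∣⊥∣≡0 n))) z≤n
    ... | yes (u , u∈) with boundary⁻ (∈-tabulate⁻ u∈)
    ...   | ¬t⊑u , s , t⊑s , us =
      ≤-trans ∣boundary∣≤size-cut
        (bonds≤c cut (cut-isBond (inside-connected t≢root) outside-connected
                                 (∈ᵇ⁺ t⊑s) (∉ᵇ ¬t⊑u) (trans (adj-sym G s u) us)))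
      where
      t≢root : t ≢ root
      t≢root refl = ¬t⊑u (root∈path u)

    ∣bags∣≤ : ∀ {c} → (∀ F → IsBond G F → size F ≤ c) → ∣ bags t ∣ ≤ suc c
    ∣bags∣≤ bonds≤c = ≤-trans (∣p∪q∣≤∣p∣+∣q∣ ⁅ t ⁆ (tabulate boundary))
      (subst (λ k → k + ∣ tabulate boundary ∣ ≤ suc _) (sym (∣⁅x⁆∣≡1 t)) (s≤s (∣boundary∣≤ bonds≤c)))

width-exists : ∀ {n} {G : Graph n} (D : TreeDecomposition G) → Fin (m D) →
               (∀ t → ∃ λ x → x ∈ bag D t) → ∃ (HasWidth D)
width-exists D t₀ inhabited = width ∣ bag D t* ∣ refl
  where
  ∣bag∣ : Fin (m D) → ℕ
  ∣bag∣ t = ∣ bag D t ∣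

  t* = argmax ∣bag∣ t₀ (List.allFin (m D))

  maximal : ∀ t → ∣bag∣ t ≤ ∣bag∣ t*
  maximal t = All.lookup (f[xs]≤f[argmax] t₀ (List.allFin (m D))) (∈-allFin t)

  width : ∀ k → ∣bag∣ t* ≡ k → ∃ (HasWidth D)
  width zero    e = let (x , x∈) = inhabited t* in ⊥-elim (n≮0 (subst (0 <_) e (x∈p⇒0<∣p∣ x∈)))
  width (suc w) e = w , (λ t → subst (∣bag∣ t ≤_) e (maximal t)) , t* , e

width≤ : ∀ {n} {G : Graph n} {D : TreeDecomposition G} {w c} → HasWidth D w →
         (∀ t → ∣ bag D t ∣ ≤ suc c) → w ≤ c
width≤ {c = c} (_ , t , e) bound = s≤s⁻¹ (subst (_≤ suc c) e (bound t))

theorem1p3 : ∀ {n} (G : Graph n) → HasEdge G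
           → ∀ tw c → IsTreewidth G tw → IsCocircumference G c → tw ≤ c
theorem1p3 G (u , _) tw c (_ , tw-minimal) (_ , bonds≤c) =
  ≤-trans (tw-minimal D w D-width) (width≤ {D = D} D-width (λ t → ∣bags∣≤ t bonds≤c))
  where
  open Decomposition (normalTree G u)
  D = decomposition
  width = width-exists D u (λ t → t , t∈bags t)
  w = proj₁ width
  D-width = proj₂ width
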